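{- Let $\mathcal{A}\subseteq\{\mathsf{N},\mathsf{M},\mathsf{C}\}$. If $A\in\mathsf{E}\mathcal{A}$, then the linear nested sequent $\;\Rightarrow A$ is derivable in $\mathsf{LNS}_{\mathsf{E}\mathcal{A}}$ extended with contraction and weakening.
   Context: Formulas are built from propositional variables, $\bot,\top,\neg,\land,\lor,\to,\Box$. The logic $\mathsf{E}\mathcal{A}$ is the smallest set of formulas containing all propositional tautologies and the axioms in $\mathcal{A}$, closed under modus ponens and the rule (E): from $A\to B$ and $B\to A$ infer $\Box A\to\Box B$, where the axioms are $\mathsf{M}: \Box(A\land B)\to(\Box A\land\Box B)$, $\mathsf{C}: (\Box A\land\Box B)\to\Box(A\land B)$, $\mathsf{N}: \Box\top$. Linear nested sequents for this setting are given by the grammar $\mathcal{X}::=\Gamma\Rightarrow\Delta\mid\Gamma\Rightarrow\Delta\,/_{\mathsf e}(\Sigma\Rightarrow\Pi;\Omega\Rightarrow\Theta)\mid\Gamma\Rightarrow\Delta\,/\,\mathcal{X}$ (finite multisets of formulas; the binary nesting $/_{\mathsf e}$ may only occur at the end). $\mathcal{S}\{\Gamma\Rightarrow\Delta\}$ denotes such a structure with a distinguished component; $\mathcal{G}/\Gamma\Rightarrow\Delta$ denotes one whose last component is $\Gamma\Rightarrow\Delta$ (prefix possibly empty). $\mathsf{LNS}_{\mathsf{E}\mathcal{A}}$ consists of: propositional rules (zero-premiss $\mathcal{S}\{\Gamma,p\Rightarrow p,\Delta\}$ for atomic $p$, $\mathcal{S}\{\Gamma,\bot\Rightarrow\Delta\}$,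 $\mathcal{S}\{\Gamma\Rightarrow\top,\Delta\}$, and the standard two-sided invertible rules for $\neg,\land,\lor,\to$ acting on one component, e.g. $\to_L$: from $\mathcal{S}\{\Gamma,B\Rightarrow\Delta\}$ and $\mathcal{S}\{\Gamma\Rightarrow A,\Delta\}$ infer $\mathcal{S}\{\Gamma,A\to B\Rightarrow\Delta\}$), which may not be applied to the sequents inside the nesting $/_{\mathsf e}$; the rules $\Box^{\mathsf e}_R$: from $\mathcal{G}/\Gamma\Rightarrow\Delta\,/_{\mathsf e}(\Rightarrow B;B\Rightarrow)$ infer $\mathcal{G}/\Gamma\Rightarrow\Box B,\Delta$; $\Box^{\mathsf e}_L$: from $\mathcal{G}/\Gamma\Rightarrow\Delta/\Sigma,A\Rightarrow\Pi$ and $\mathcal{G}/\Gamma\Rightarrow\Delta/\Omega\Rightarrow A,\Theta$ infer $\mathcal{G}/\Gamma,\Box A\Rightarrow\Delta\,/_{\mathsf e}(\Sigma\Rightarrow\Pi;\Omega\Rightarrow\Theta)$; and for each element of $\mathcal{A}$ the rule: $\mathsf{N}$: from $\mathcal{G}/\Gamma\Rightarrow\Delta/\Rightarrow B$ infer $\mathcal{G}/\Gamma\Rightarrow\Box B,\Delta$; $\mathsf{M}$: from $\mathcal{G}\,/_{\mathsf e}(\Sigma\Rightarrow\Pi;\Omega,\bot\Rightarrow\Theta)$ infer $\mathcal{G}\,/_{\mathsf e}(\Sigma\Rightarrow\Pi;\Omega\Rightarrow\Theta)$; $\mathsf{C}$: from $\mathcal{G}/\Gamma\Rightarrow\Delta\,/_{\mathsf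 e}(\Sigma,A\Rightarrow\Pi;\Omega\Rightarrow\Theta)$ and $\mathcal{G}/\Gamma\Rightarrow\Delta/\Omega\Rightarrow A,\Theta$ infer $\mathcal{G}/\Gamma,\Box A\Rightarrow\Delta\,/_{\mathsf e}(\Sigma\Rightarrow\Pi;\Omega\Rightarrow\Theta)$. Contraction and weakening are the usual left/right rules inside a component. -}

module Defs where

open import Data.Nat using (ℕ)
open import Data.Bool using (Bool; true; false; not; _∧_; _∨_)
open import Data.List using (List; []; _∷_)
open import Data.List.Relation.Binary.Permutation.Propositional using (_↭_)
open import Relation.Binary.PropositionalEquality using (_≡_)
open import Data.Product using (_×_)

infixr 30 ¬ᶠ_ □_
infixr 25 _∧ᶠ_
infixr 24 _∨ᶠ_
infixr 20 _→ᶠ_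

data Fm : Set where
  var   : ℕ → Fm
  ⊥ᶠ ⊤ᶠ : Fm
  ¬ᶠ_   : Fm → Fm
  _∧ᶠ_  : Fm → Fm → Fm
  _∨ᶠ_  : Fm → Fm → Fm
  _→ᶠ_  : Fm → Fm → Fm
  □_    : Fm → Fm

-- Propositional tautologies (substitution instances of classical
-- tautologies): true under every Boolean valuation that treats
-- variables and boxed formulas as atoms.

eval : (ℕ → Bool) → (Fm → Bool) → Fm → Bool
eval v w (var n)   = v n
eval v w ⊥ᶠ        = false
eval v w ⊤ᶠ        = true
eval v w (¬ᶠ A)    = not (eval v w A)
eval v w (A ∧ᶠ B)  = eval v w A ∧ eval v w B
eval v w (A ∨ᶠ B)  = eval v w A ∨ eval v w B
eval v w (A →ᶠ B)  = not (eval v w A) ∨ eval v w B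
eval v w (□ A)     = w A

Tautology : Fm → Set
Tautology A = (v : ℕ → Bool) (w : Fm → Bool) → eval v w A ≡ true

data Ax : Set where
  N M C : Ax

AxSet : Set
AxSet = Ax → Bool

_∈𝒜_ : Ax → AxSet → Set
a ∈𝒜 𝒜 = 𝒜 a ≡ true

data Thm (𝒜 : AxSet) : Fm → Set where
  taut : ∀ {A} → Tautology A → Thm 𝒜 A
  axM  : ∀ {A B} → M ∈𝒜 𝒜 → Thm 𝒜 (□ (A ∧ᶠ B) →ᶠ (□ A ∧ᶠ □ B))
  axC  : ∀ {A B} → C ∈𝒜 𝒜 → Thm 𝒜 ((□ A ∧ᶠ □ B) →ᶠ □ (A ∧ᶠ B))
  axN  : N ∈𝒜 𝒜 → Thm 𝒜 (□ ⊤ᶠ)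
  mp   : ∀ {A B} → Thm 𝒜 (A →ᶠ B) → Thm 𝒜 A → Thm 𝒜 B
  ruleE : ∀ {A B} → Thm 𝒜 (A →ᶠ B) → Thm 𝒜 (B →ᶠ A) → Thm 𝒜 (□ A →ᶠ □ B)

-- Sequents and linear nested sequents.
-- Multisets are lists; "Γ , A" is written  A ∷ Γ ; multiset identity is
-- recovered by the exchange rule (componentwise permutation).

infix 4 _⇒_
record Seq : Set where
  constructor _⇒_
  field
    ante : List Fm
    succ : List Fm

-- X ::= Γ⇒Δ | Γ⇒Δ /ₑ (Σ⇒Π ; Ω⇒Θ) | Γ⇒Δ / X
infixr 3 _/_
data LNS : Set where
  end  : Seq → LNS
  endE : Seq → Seq → Seq → LNS      -- endE s t u  =  s /ₑ (t ; u)
  _/_  : Seq → LNS → LNS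

-- What follows a distinguished component.
data Suffix : Set where
  nil  : Suffix
  eN   : Seq → Seq → Suffix
  more : LNS → Suffix

fill : List Seq → Seq → Suffix → LNS
fill []      s nil        = end s
fill []      s (eN t u)   = endE s t u
fill []      s (more X)   = s / X
fill (g ∷ G) s suf        = g / fill G s suf

_≈ₛ_ : Seq → Seq → Set
(Γ ⇒ Δ) ≈ₛ (Γ' ⇒ Δ') = (Γ ↭ Γ') × (Δ ↭ Δ')

data _≈_ : LNS → LNS → Set where
  end≈  : ∀ {s s'} → s ≈ₛ s' → end s ≈ end s'
  endE≈ : ∀ {s s' t t' u u'} → s ≈ₛ s' → t ≈ₛ t' → u ≈ₛ u' →
          endE s t u ≈ endE s' t' u'
  /≈    : ∀ {s s' X X'} → s ≈ₛ s' → X ≈ X' → (s / X) ≈ (s' / X')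

-- LNS_{E𝒜} extended with contraction and weakening.
-- S{Γ⇒Δ} = fill G (Γ⇒Δ) suf  (any component, never one inside /ₑ);
-- G/Γ⇒Δ  = fill G (Γ⇒Δ) nil.

data Der (𝒜 : AxSet) : LNS → Set where
  exch : ∀ {X Y} → Der 𝒜 X → X ≈ Y → Der 𝒜 Y

  init : ∀ {G suf Γ Δ n} → Der 𝒜 (fill G (var n ∷ Γ ⇒ var n ∷ Δ) suf)
  ⊥L   : ∀ {G suf Γ Δ} → Der 𝒜 (fill G (⊥ᶠ ∷ Γ ⇒ Δ) suf)
  ⊤R   : ∀ {G suf Γ Δ} → Der 𝒜 (fill G (Γ ⇒ ⊤ᶠ ∷ Δ) suf)
  ¬L   : ∀ {G suf Γ Δ A} → Der 𝒜 (fill G (Γ ⇒ A ∷ Δ) suf) →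
         Der 𝒜 (fill G (¬ᶠ A ∷ Γ ⇒ Δ) suf)
  ¬R   : ∀ {G suf Γ Δ A} → Der 𝒜 (fill G (A ∷ Γ ⇒ Δ) suf) →
         Der 𝒜 (fill G (Γ ⇒ ¬ᶠ A ∷ Δ) suf)
  ∧L   : ∀ {G suf Γ Δ A B} → Der 𝒜 (fill G (A ∷ B ∷ Γ ⇒ Δ) suf) →
         Der 𝒜 (fill G (A ∧ᶠ B ∷ Γ ⇒ Δ) suf)
  ∧R   : ∀ {G suf Γ Δ A B} → Der 𝒜 (fill G (Γ ⇒ A ∷ Δ) suf) →
         Der 𝒜 (fill G (Γ ⇒ B ∷ Δ) suf) →
         Der 𝒜 (fill G (Γ ⇒ A ∧ᶠ B ∷ Δ) suf)
  ∨L   : ∀ {G suf Γ Δ A B} → Der 𝒜 (fill G (A ∷ Γ ⇒ Δ) suf) →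
         Der 𝒜 (fill G (B ∷ Γ ⇒ Δ) suf) →
         Der 𝒜 (fill G (A ∨ᶠ B ∷ Γ ⇒ Δ) suf)
  ∨R   : ∀ {G suf Γ Δ A B} → Der 𝒜 (fill G (Γ ⇒ A ∷ B ∷ Δ) suf) →
         Der 𝒜 (fill G (Γ ⇒ A ∨ᶠ B ∷ Δ) suf)
  →L   : ∀ {G suf Γ Δ A B} → Der 𝒜 (fill G (B ∷ Γ ⇒ Δ) suf) →
         Der 𝒜 (fill G (Γ ⇒ A ∷ Δ) suf) →
         Der 𝒜 (fill G (A →ᶠ B ∷ Γ ⇒ Δ) suf)
  →R   : ∀ {G suf Γ Δ A B} → Der 𝒜 (fill G (A ∷ Γ ⇒ B ∷ Δ) suf) →
         Der 𝒜 (fill G (Γ ⇒ A →ᶠ B ∷ Δ) suf)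

  □ᵉR  : ∀ {G Γ Δ B} →
         Der 𝒜 (fill G (Γ ⇒ Δ) (eN ([] ⇒ B ∷ []) (B ∷ [] ⇒ []))) →
         Der 𝒜 (fill G (Γ ⇒ □ B ∷ Δ) nil)
  □ᵉL  : ∀ {G Γ Δ Σ Π Ω Θ A} →
         Der 𝒜 (fill G (Γ ⇒ Δ) (more (end (A ∷ Σ ⇒ Π)))) →
         Der 𝒜 (fill G (Γ ⇒ Δ) (more (end (Ω ⇒ A ∷ Θ)))) →
         Der 𝒜 (fill G (□ A ∷ Γ ⇒ Δ) (eN (Σ ⇒ Π) (Ω ⇒ Θ)))

  ruleN : ∀ {G Γ Δ B} → N ∈𝒜 𝒜 →
          Der 𝒜 (fill G (Γ ⇒ Δ) (more (end ([] ⇒ B ∷ [])))) →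
          Der 𝒜 (fill G (Γ ⇒ □ B ∷ Δ) nil)
  ruleM : ∀ {G s Σ Π Ω Θ} → M ∈𝒜 𝒜 →
          Der 𝒜 (fill G s (eN (Σ ⇒ Π) (⊥ᶠ ∷ Ω ⇒ Θ))) →
          Der 𝒜 (fill G s (eN (Σ ⇒ Π) (Ω ⇒ Θ)))
  ruleC : ∀ {G Γ Δ Σ Π Ω Θ A} → C ∈𝒜 𝒜 →
          Der 𝒜 (fill G (Γ ⇒ Δ) (eN (A ∷ Σ ⇒ Π) (Ω ⇒ Θ))) →
          Der 𝒜 (fill G (Γ ⇒ Δ) (more (end (Ω ⇒ A ∷ Θ)))) →
          Der 𝒜 (fill G (□ A ∷ Γ ⇒ Δ) (eN (Σ ⇒ Π) (Ω ⇒ Θ)))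

  wL   : ∀ {G suf Γ Δ A} → Der 𝒜 (fill G (Γ ⇒ Δ) suf) →
         Der 𝒜 (fill G (A ∷ Γ ⇒ Δ) suf)
  wR   : ∀ {G suf Γ Δ A} → Der 𝒜 (fill G (Γ ⇒ Δ) suf) →
         Der 𝒜 (fill G (Γ ⇒ A ∷ Δ) suf)
  cL   : ∀ {G suf Γ Δ A} → Der 𝒜 (fill G (A ∷ A ∷ Γ ⇒ Δ) suf) →
         Der 𝒜 (fill G (A ∷ Γ ⇒ Δ) suf)
  cR   : ∀ {G suf Γ Δ A} → Der 𝒜 (fill G (Γ ⇒ A ∷ A ∷ Δ) suf) →
         Der 𝒜 (fill G (Γ ⇒ A ∷ Δ) suf)

module Submission where

-- The proof goes through an auxiliary cut-free sequent calculus Γ ⊢ Δ for E𝒜 whose contexts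
-- are read up to inclusion and whose only modal rule infers  Γ, □A₁, …, □Aₙ ⇒ □B, Δ  from
-- A₁, …, Aₙ ⇒ B  and, when M ∉ 𝒜, from  B ⇒ Aᵢ  for every i; here n ≥ 1 unless N ∈ 𝒜 and n ≤ 1
-- unless C ∈ 𝒜.  Tautologies are derivable there by exhaustive proof search, since a failed
-- search on an atomic sequent yields the valuation making exactly its antecedent atoms true.
-- Modus ponens is handled by cut admissibility: propositional cuts reduce through inversion,
-- and the only modal case merges the rule concluding □B with a rule using □B on its left into
-- a single modal rule whose premisses arise from cuts on B.  Finally each rule of Γ ⊢ Δ is
-- simulated in LNS_E𝒜: the modal rule becomes □ᵉR (or N when n = 0) followed by C for all
-- but one boxed antecedent and □ᵉL for the last, where in presence of M the side premisses
-- Ω ⇒ Aᵢ become ⊥-axioms.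

open import Defs

import Algebra.Properties.CommutativeSemigroup as CommutativeSemigroupProperties
open import Data.Bool using (Bool; true; false; not; _∧_; _∨_)
open import Data.Bool.Properties using (∨-zeroʳ; ∧-conicalˡ; ∧-conicalʳ)
open import Data.Empty using (⊥-elim)
open import Data.List using (List; []; _∷_; [_]; _++_; length; map; filter)
open import Data.List.Membership.Propositional using (_∈_; _∉_; find; lose)
open import Data.List.Membership.Propositional.Properties using (∈-++⁻; ∈-∃++; ∈-filter⁺; ∈-filter⁻)
open import Data.List.Properties
  using (∷-injective; ++-assoc; map-++; length-++; length-++-≤ˡ; filter-notAll)
open import Data.List.Relation.Binary.Permutation.Propositional
  using (_↭_; ↭-refl; ↭-sym; ↭-prep; ↭-swap)
open import Data.List.Relation.Binary.Permutation.Propositional.Properties using (shift; ++-comm)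
open import Data.List.Relation.Binary.Subset.Propositional using (_⊆_)
open import Data.List.Relation.Binary.Subset.Propositional.Properties
  using (Any-resp-⊆; All-resp-⊇; ⊆-refl; ⊆-trans; ⊆-reflexive; ⊆-reflexive-↭; xs⊆x∷xs; ∷⁺ʳ; ∈-∷⁺ʳ;
         xs⊆xs++ys; xs⊆ys++xs; ++⁺ʳ)
open import Data.List.Relation.Unary.All as All using (All; []; _∷_; lookup)
import Data.List.Relation.Unary.All.Properties as All
open import Data.List.Relation.Unary.Any as Any using (Any; here; there; tail)
import Data.List.Relation.Unary.Any.Properties as Any
open import Data.Maybe using (Maybe; just; nothing)
import Data.Maybe as Maybe
open import Data.Maybe.Properties using (just-injective)
open import Data.Nat as ℕ using (ℕ; suc; _+_; _≤_; _<_; _>_; z≤n; s≤s)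
open import Data.Nat.Induction using (<-wellFounded)
open import Data.Nat.ListAction using (sum)
open import Data.Nat.ListAction.Properties using (sum-++)
open import Data.Nat.Properties
  using (≤-trans; ≤-reflexive; +-mono-≤; +-monoˡ-<; +-identityʳ; +-assoc; m≤m+n; m≤n+m; m<n+m;
         +-commutativeSemigroup)
open import Data.Product using (_×_; _,_; proj₁; proj₂)
open import Data.Sum as Sum using (_⊎_; inj₁; inj₂)
open import Function using (_∘_)
open import Induction.WellFounded using (Acc; acc)
open import Relation.Binary.Definitions using (DecidableEquality)
open import Relation.Binary.PropositionalEquality
  using (_≡_; _≢_; refl; sym; trans; cong; cong₂; subst; subst₂)
open import Relation.Nullary using (Dec; yes; no; does; ¬_)
open import Relation.Nullary.Decidable using (map′; _×-dec_; ¬?; dec-true)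

-- Formulas embed into ℕ-labelled rose trees, whose equality is decided by a short
-- mutual recursion; this avoids a case analysis on all pairs of connectives.
module FmEquality where
  private
    data Tree : Set where
      node : ℕ → List Tree → Tree

    node-injective : ∀ {m n ts us} → node m ts ≡ node n us → m ≡ n × ts ≡ us
    node-injective refl = refl , refl

    mutual
      _≟ᵀ_ : DecidableEquality Tree
      node m ts ≟ᵀ node n us =
        map′ (λ (p , q) → cong₂ node p q) node-injective (m ℕ.≟ n ×-dec ts ≟ᵀˢ us)

      _≟ᵀˢ_ : DecidableEquality (List Tree)
      []       ≟ᵀˢ []       = yes refl
      []       ≟ᵀˢ (_ ∷ _)  = no λ ()
      (_ ∷ _)  ≟ᵀˢ []       = no λ ()
      (t ∷ ts) ≟ᵀˢ (u ∷ us) =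
        map′ (λ (p , q) → cong₂ _∷_ p q) ∷-injective (t ≟ᵀ u ×-dec ts ≟ᵀˢ us)

    encode : Fm → Tree
    encode (var n)  = node 0 [ node n [] ]
    encode ⊥ᶠ       = node 1 []
    encode ⊤ᶠ       = node 2 []
    encode (¬ᶠ A)   = node 3 [ encode A ]
    encode (A ∧ᶠ B) = node 4 (encode A ∷ encode B ∷ [])
    encode (A ∨ᶠ B) = node 5 (encode A ∷ encode B ∷ [])
    encode (A →ᶠ B) = node 6 (encode A ∷ encode B ∷ [])
    encode (□ A)    = node 7 [ encode A ]

    decode : Tree → Maybe Fm
    decode (node 0 (node n [] ∷ [])) = just (var n)
    decode (node 1 [])               = just ⊥ᶠ
    decode (node 2 [])               = just ⊤ᶠ
    decode (node 3 (t ∷ []))         = Maybe.map ¬ᶠ_ (decode t)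
    decode (node 4 (t ∷ u ∷ []))     = Maybe.zipWith _∧ᶠ_ (decode t) (decode u)
    decode (node 5 (t ∷ u ∷ []))     = Maybe.zipWith _∨ᶠ_ (decode t) (decode u)
    decode (node 6 (t ∷ u ∷ []))     = Maybe.zipWith _→ᶠ_ (decode t) (decode u)
    decode (node 7 (t ∷ []))         = Maybe.map □_ (decode t)
    decode _                         = nothing

    decode-encode : ∀ A → decode (encode A) ≡ just A
    decode-encode (var n)  = refl
    decode-encode ⊥ᶠ       = refl
    decode-encode ⊤ᶠ       = refl
    decode-encode (¬ᶠ A)   rewrite decode-encode A = refl
    decode-encode (A ∧ᶠ B) rewrite decode-encode A | decode-encode B = refl
    decode-encode (A ∨ᶠ B) rewrite decode-encode A | decode-encode B = refl
    decode-encode (A →ᶠ B) rewrite decode-encode A | decode-encode B = refl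
    decode-encode (□ A)    rewrite decode-encode A = refl

    encode-injective : ∀ {A B} → encode A ≡ encode B → A ≡ B
    encode-injective {A} {B} e =
      just-injective (trans (sym (decode-encode A)) (trans (cong decode e) (decode-encode B)))

  infix 4 _≟_
  _≟_ : DecidableEquality Fm
  A ≟ B = map′ encode-injective (cong encode) (encode A ≟ᵀ encode B)

open FmEquality using (_≟_)
open import Data.List.Membership.DecPropositional _≟_ using (_∈?_)

module _ {X : Set} where

  ∷-++-⊆ : ∀ {x : X} {Γ₀ Γ} Π → Γ₀ ⊆ x ∷ Γ → Π ++ Γ₀ ⊆ x ∷ Π ++ Γ
  ∷-++-⊆ {x} {Γ = Γ} Π s = ⊆-trans (++⁺ʳ Π s) (⊆-reflexive-↭ (shift x Π Γ))

  ++-⊆ : ∀ {xs ys zs : List X} → xs ⊆ zs → ys ⊆ zs → xs ++ ys ⊆ zs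
  ++-⊆ {xs} s t i with ∈-++⁻ xs i
  ... | inj₁ j = s j
  ... | inj₂ j = t j

  swap-⊆ : ∀ {x y : X} {Γ} → x ∷ y ∷ Γ ⊆ y ∷ x ∷ Γ
  swap-⊆ {x} {y} = ⊆-reflexive-↭ (↭-swap x y ↭-refl)

_≢?_ : ∀ X B → Dec (X ≢ B)
X ≢? B = ¬? (X ≟ B)

without : Fm → List Fm → List Fm
without B = filter (_≢? B)

⊆-∷-without : ∀ B Cs → Cs ⊆ B ∷ without B Cs
⊆-∷-without B Cs {X} i with X ≟ B
... | yes refl = here refl
... | no X≢B   = there (∈-filter⁺ (_≢? B) i X≢B)

without-shorter : ∀ {B Cs} → B ∈ Cs → length (without B Cs) < length Cs
without-shorter {B} {Cs} i = filter-notAll (_≢? B) Cs (Any.map (λ { refl B≢B → B≢B refl }) i)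

□-injective : ∀ {A B} → □ A ≡ □ B → A ≡ B
□-injective refl = refl

boxes-⊆ : ∀ {As Γ} → All (λ A → □ A ∈ Γ) As → map □_ As ⊆ Γ
boxes-⊆ {Γ = Γ} bs = lookup (All.map⁺ {P = _∈ Γ} bs)

module _ {B : Fm} {Γ : List Fm} where

  boxes-without : ∀ {Cs} → All (λ X → □ X ∈ □ B ∷ Γ) Cs → All (λ X → □ X ∈ Γ) (without B Cs)
  boxes-without bs = All.tabulate λ i →
    let (X∈Cs , X≢B) = ∈-filter⁻ (_≢? B) i in tail (X≢B ∘ □-injective) (lookup bs X∈Cs)

  boxes-∉ : ∀ {Cs} → B ∉ Cs → All (λ X → □ X ∈ □ B ∷ Γ) Cs → All (λ X → □ X ∈ Γ) Cs
  boxes-∉ B∉ bs = All.tabulate λ i →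
    tail (λ e → B∉ (subst (_∈ _) (□-injective e) i)) (lookup bs i)

≈ₛ-refl : ∀ s → s ≈ₛ s
≈ₛ-refl (Γ ⇒ Δ) = ↭-refl , ↭-refl

≈-refl : ∀ X → X ≈ X
≈-refl (end s)      = end≈ (≈ₛ-refl s)
≈-refl (endE s t u) = endE≈ (≈ₛ-refl s) (≈ₛ-refl t) (≈ₛ-refl u)
≈-refl (s / X)      = /≈ (≈ₛ-refl s) (≈-refl X)

fill-≈ : ∀ G suf {s s′} → s ≈ₛ s′ → fill G s suf ≈ fill G s′ suf
fill-≈ []      nil      p = end≈ p
fill-≈ []      (eN t u) p = endE≈ p (≈ₛ-refl t) (≈ₛ-refl u)
fill-≈ []      (more X) p = /≈ p (≈-refl X)
fill-≈ (g ∷ G) suf      p = /≈ (≈ₛ-refl g) (fill-≈ G suf p)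

fill-more : ∀ G s t → fill G s (more (end t)) ≡ fill (G ++ [ s ]) t nil
fill-more []      s t = refl
fill-more (g ∷ G) s t = cong (g /_) (fill-more G s t)

module _ {𝒜 : AxSet} {G : List Seq} {suf : Suffix} where

  private
    Der′ : List Fm → List Fm → Set
    Der′ Γ Δ = Der 𝒜 (fill G (Γ ⇒ Δ) suf)

  exchange : ∀ {Γ Γ′ Δ Δ′} → Γ ↭ Γ′ → Δ ↭ Δ′ → Der′ Γ Δ → Der′ Γ′ Δ′
  exchange p q d = exch d (fill-≈ G suf (p , q))

  weakenˡ* : ∀ {Γ Δ} Ξ → Der′ Γ Δ → Der′ (Ξ ++ Γ) Δ
  weakenˡ* []      d = d
  weakenˡ* (_ ∷ Ξ) d = wL (weakenˡ* Ξ d)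

  weakenʳ* : ∀ {Γ Δ} Ξ → Der′ Γ Δ → Der′ Γ (Ξ ++ Δ)
  weakenʳ* []      d = d
  weakenʳ* (_ ∷ Ξ) d = wR (weakenʳ* Ξ d)

  contractˡ : ∀ {A Γ Δ} → A ∈ Γ → Der′ (A ∷ Γ) Δ → Der′ Γ Δ
  contractˡ {A} i d with Ξ , Ξ′ , refl ← ∈-∃++ i =
    exchange (↭-sym (shift A Ξ Ξ′)) ↭-refl (cL (exchange (↭-prep A (shift A Ξ Ξ′)) ↭-refl d))

  contractʳ : ∀ {A Γ Δ} → A ∈ Δ → Der′ Γ (A ∷ Δ) → Der′ Γ Δ
  contractʳ {A} i d with Ξ , Ξ′ , refl ← ∈-∃++ i =
    exchange ↭-refl (↭-sym (shift A Ξ Ξ′)) (cR (exchange ↭-refl (↭-prep A (shift A Ξ Ξ′)) d))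

  contractˡ* : ∀ {Γ Δ} Ξ → Ξ ⊆ Γ → Der′ (Ξ ++ Γ) Δ → Der′ Γ Δ
  contractˡ* []      s d = d
  contractˡ* (A ∷ Ξ) s d = contractˡ* Ξ (s ∘ there) (contractˡ (xs⊆ys++xs _ Ξ (s (here refl))) d)

  contractʳ* : ∀ {Γ Δ} Ξ → Ξ ⊆ Δ → Der′ Γ (Ξ ++ Δ) → Der′ Γ Δ
  contractʳ* []      s d = d
  contractʳ* (A ∷ Ξ) s d = contractʳ* Ξ (s ∘ there) (contractʳ (xs⊆ys++xs _ Ξ (s (here refl))) d)

  Der-⊆ : ∀ {Γ Γ′ Δ Δ′} → Γ ⊆ Γ′ → Δ ⊆ Δ′ → Der′ Γ Δ → Der′ Γ′ Δ′
  Der-⊆ {Γ} {Γ′} {Δ} {Δ′} s t d =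
    contractʳ* Δ t (exchange ↭-refl (++-comm Δ′ Δ) (weakenʳ* Δ′
      (contractˡ* Γ s (exchange (++-comm Γ′ Γ) ↭-refl (weakenˡ* Γ′ d)))))

data NonAtomic : Fm → Set where
  ⊥ⁿ : NonAtomic ⊥ᶠ
  ⊤ⁿ : NonAtomic ⊤ᶠ
  ¬ⁿ : ∀ {A} → NonAtomic (¬ᶠ A)
  ∧ⁿ : ∀ {A B} → NonAtomic (A ∧ᶠ B)
  ∨ⁿ : ∀ {A B} → NonAtomic (A ∨ᶠ B)
  →ⁿ : ∀ {A B} → NonAtomic (A →ᶠ B)

data Atomic : Fm → Set where
  varᵃ : ∀ {n} → Atomic (var n)
  □ᵃ   : ∀ {A} → Atomic (□ A)

atomic? : ∀ A → Atomic A ⊎ NonAtomic A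
atomic? (var n)  = inj₁ varᵃ
atomic? ⊥ᶠ       = inj₂ ⊥ⁿ
atomic? ⊤ᶠ       = inj₂ ⊤ⁿ
atomic? (¬ᶠ A)   = inj₂ ¬ⁿ
atomic? (A ∧ᶠ B) = inj₂ ∧ⁿ
atomic? (A ∨ᶠ B) = inj₂ ∨ⁿ
atomic? (A →ᶠ B) = inj₂ →ⁿ
atomic? (□ A)    = inj₁ □ᵃ

nonAtomic-irrelevant : ∀ {A} (c c′ : NonAtomic A) → c ≡ c′
nonAtomic-irrelevant ⊥ⁿ ⊥ⁿ = refl
nonAtomic-irrelevant ⊤ⁿ ⊤ⁿ = refl
nonAtomic-irrelevant ¬ⁿ ¬ⁿ = refl
nonAtomic-irrelevant ∧ⁿ ∧ⁿ = refl
nonAtomic-irrelevant ∨ⁿ ∨ⁿ = refl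
nonAtomic-irrelevant →ⁿ →ⁿ = refl

nonAtomic≢atomic : ∀ {A X} → NonAtomic A → Atomic X → A ≢ X
nonAtomic≢atomic () varᵃ refl
nonAtomic≢atomic () □ᵃ refl

-- A premiss (Π , Σ) of a rule stands for  Π , Γ ⇒ Σ , Δ  where  Γ ⇒ Δ  is the conclusion.
-- The principal formula stays in the conclusion's context, so contraction is built in;
-- the premisses are listed in the order of the corresponding LNS rules.
Premiss : Set
Premiss = List Fm × List Fm

leftPremisses : ∀ {A} → NonAtomic A → List Premiss
leftPremisses ⊥ⁿ           = []
leftPremisses ⊤ⁿ           = [ ([] , []) ]
leftPremisses (¬ⁿ {A})     = [ ([] , [ A ]) ]
leftPremisses (∧ⁿ {A} {B}) = [ (A ∷ B ∷ [] , []) ]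
leftPremisses (∨ⁿ {A} {B}) = ([ A ] , []) ∷ ([ B ] , []) ∷ []
leftPremisses (→ⁿ {A} {B}) = ([ B ] , []) ∷ ([] , [ A ]) ∷ []

rightPremisses : ∀ {A} → NonAtomic A → List Premiss
rightPremisses ⊥ⁿ           = [ ([] , []) ]
rightPremisses ⊤ⁿ           = []
rightPremisses (¬ⁿ {A})     = [ ([ A ] , []) ]
rightPremisses (∧ⁿ {A} {B}) = ([] , [ A ]) ∷ ([] , [ B ]) ∷ []
rightPremisses (∨ⁿ {A} {B}) = [ ([] , A ∷ B ∷ []) ]
rightPremisses (→ⁿ {A} {B}) = [ ([ A ] , [ B ]) ]

Holds : (ℕ → Bool) → (Fm → Bool) → Fm → Set
Holds v w A = eval v w A ≡ true

Valid : List Fm → List Fm → Set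
Valid Γ Δ = ∀ v w → All (Holds v w) Γ → Any (Holds v w) Δ

valid-weaken : ∀ {Γ Γ′ Δ Δ′} → Γ ⊆ Γ′ → Δ ⊆ Δ′ → Valid Γ Δ → Valid Γ′ Δ′
valid-weaken s t V v w h = Any-resp-⊆ t (V v w (All-resp-⊇ s h))

excluded-middle : ∀ v w A → Holds v w A ⊎ Holds v w (¬ᶠ A)
excluded-middle v w A with eval v w A
... | true  = inj₁ refl
... | false = inj₂ refl

∨-≡-true : ∀ a {b} → a ∨ b ≡ true → a ≡ true ⊎ b ≡ true
∨-≡-true true  _ = inj₁ refl
∨-≡-true false h = inj₂ h

not-≡-true : ∀ a → not a ≡ true → a ≢ true
not-≡-true true  () _
not-≡-true false _  ()

→-≡-true : ∀ a {b} → not a ∨ b ≡ true → a ≡ true → b ≡ true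
→-≡-true true  h _  = h
→-≡-true false _ ()

from-does : ∀ {P : Set} (P? : Dec P) → does P? ≡ true → P
from-does (yes p) _ = p

LeftSound : (ℕ → Bool) → (Fm → Bool) → Fm → Premiss → Set
LeftSound v w A (Π , Σ) = All (Holds v w) Π → Any (Holds v w) Σ ⊎ Holds v w A

RightSound : (ℕ → Bool) → (Fm → Bool) → Fm → Premiss → Set
RightSound v w A (Π , Σ) = Holds v w A → All (Holds v w) Π → Any (Holds v w) Σ

leftPremisses-sound : ∀ {A} (c : NonAtomic A) v w → All (LeftSound v w A) (leftPremisses c)
leftPremisses-sound ⊥ⁿ v w = []
leftPremisses-sound ⊤ⁿ v w = (λ _ → inj₂ refl) ∷ []
leftPremisses-sound (¬ⁿ {A}) v w = (λ _ → Sum.map₁ here (excluded-middle v w A)) ∷ []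
leftPremisses-sound ∧ⁿ v w = (λ { (a ∷ b ∷ []) → inj₂ (cong₂ _∧_ a b) }) ∷ []
leftPremisses-sound (∨ⁿ {A}) v w =
    (λ { (a ∷ []) → inj₂ (cong (_∨ _) a) })
  ∷ (λ { (b ∷ []) → inj₂ (trans (cong (eval v w A ∨_) b) (∨-zeroʳ _)) }) ∷ []
leftPremisses-sound (→ⁿ {A} {B}) v w =
    (λ { (b ∷ []) → inj₂ (trans (cong (not (eval v w A) ∨_) b) (∨-zeroʳ _)) })
  ∷ (λ _ → Sum.map here (cong (_∨ eval v w B)) (excluded-middle v w A)) ∷ []

rightPremisses-sound : ∀ {A} (c : NonAtomic A) v w → All (RightSound v w A) (rightPremisses c)
rightPremisses-sound ⊥ⁿ v w = (λ ()) ∷ []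
rightPremisses-sound ⊤ⁿ v w = []
rightPremisses-sound (¬ⁿ {A}) v w =
  (λ { h (a ∷ []) → ⊥-elim (not-≡-true (eval v w A) h a) }) ∷ []
rightPremisses-sound (∧ⁿ {A}) v w =
  (λ h _ → here (∧-conicalˡ _ _ h)) ∷ (λ h _ → here (∧-conicalʳ (eval v w A) _ h)) ∷ []
rightPremisses-sound (∨ⁿ {A}) v w =
  (λ h _ → Sum.[ here , there ∘ here ]′ (∨-≡-true (eval v w A) h)) ∷ []
rightPremisses-sound (→ⁿ {A}) v w =
  (λ { h (a ∷ []) → here (→-≡-true (eval v w A) h a) }) ∷ []

valid-left : ∀ {X Π Σ Γ Δ} (c : NonAtomic X) → (Π , Σ) ∈ leftPremisses c →
             Valid (X ∷ Γ) Δ → Valid (Π ++ Γ) (Σ ++ Δ)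
valid-left {Π = Π} {Σ} c i V v w h with lookup (leftPremisses-sound c v w) i (All.++⁻ˡ Π h)
... | inj₁ hΣ = Any.++⁺ˡ hΣ
... | inj₂ hX = Any.++⁺ʳ Σ (V v w (hX ∷ All.++⁻ʳ Π h))

valid-right : ∀ {X Π Σ Γ Δ} (c : NonAtomic X) → (Π , Σ) ∈ rightPremisses c →
              Valid Γ (X ∷ Δ) → Valid (Π ++ Γ) (Σ ++ Δ)
valid-right {Π = Π} {Σ} c i V v w h with V v w (All.++⁻ʳ Π h)
... | here hX  = Any.++⁺ˡ (lookup (rightPremisses-sound c v w) i hX (All.++⁻ˡ Π h))
... | there hΔ = Any.++⁺ʳ Σ hΔ

-- Boxed formulas weigh 1: proof search never looks inside them.
weight : Fm → ℕ
weight (¬ᶠ A)   = suc (weight A)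
weight (A ∧ᶠ B) = suc (weight A + weight B)
weight (A ∨ᶠ B) = suc (weight A + weight B)
weight (A →ᶠ B) = suc (weight A + weight B)
weight _        = 1

atomic-weight : ∀ {A} → Atomic A → weight A > 0
atomic-weight varᵃ = s≤s z≤n
atomic-weight □ᵃ   = s≤s z≤n

measure : List Fm → ℕ
measure Γ = sum (map weight Γ)

measure-++ : ∀ Γ Δ → measure (Γ ++ Δ) ≡ measure Γ + measure Δ
measure-++ Γ Δ = trans (cong sum (map-++ weight Γ Δ)) (sum-++ (map weight Γ) (map weight Δ))

Lighter : Fm → Premiss → Set
Lighter A (Π , Σ) = measure (Π ++ Σ) < weight A

unary-lighter : ∀ a → a + 0 < suc a
unary-lighter a = s≤s (≤-reflexive (+-identityʳ a))

module _ (a b : ℕ) where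

  first-lighter : a + 0 < suc (a + b)
  first-lighter = s≤s (subst (_≤ a + b) (sym (+-identityʳ a)) (m≤m+n a b))

  second-lighter : b + 0 < suc (a + b)
  second-lighter = s≤s (subst (_≤ a + b) (sym (+-identityʳ b)) (m≤n+m b a))

  both-lighter : a + (b + 0) < suc (a + b)
  both-lighter = s≤s (≤-reflexive (cong (a +_) (+-identityʳ b)))

leftPremisses-lighter : ∀ {A} (c : NonAtomic A) → All (Lighter A) (leftPremisses c)
leftPremisses-lighter ⊥ⁿ           = []
leftPremisses-lighter ⊤ⁿ           = s≤s z≤n ∷ []
leftPremisses-lighter (¬ⁿ {A})     = unary-lighter (weight A) ∷ []
leftPremisses-lighter (∧ⁿ {A} {B}) = both-lighter (weight A) (weight B) ∷ []
leftPremisses-lighter (∨ⁿ {A} {B}) =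
  first-lighter (weight A) (weight B) ∷ second-lighter (weight A) (weight B) ∷ []
leftPremisses-lighter (→ⁿ {A} {B}) =
  second-lighter (weight A) (weight B) ∷ first-lighter (weight A) (weight B) ∷ []

rightPremisses-lighter : ∀ {A} (c : NonAtomic A) → All (Lighter A) (rightPremisses c)
rightPremisses-lighter ⊥ⁿ           = s≤s z≤n ∷ []
rightPremisses-lighter ⊤ⁿ           = []
rightPremisses-lighter (¬ⁿ {A})     = unary-lighter (weight A) ∷ []
rightPremisses-lighter (∧ⁿ {A} {B}) =
  first-lighter (weight A) (weight B) ∷ second-lighter (weight A) (weight B) ∷ []
rightPremisses-lighter (∨ⁿ {A} {B}) = both-lighter (weight A) (weight B) ∷ []
rightPremisses-lighter (→ⁿ {A} {B}) = both-lighter (weight A) (weight B) ∷ []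

lighter-left : ∀ {X} Π Σ Γ Δ → Lighter X (Π , Σ) →
               measure (Π ++ Γ) + measure (Σ ++ Δ) < measure (X ∷ Γ) + measure Δ
lighter-left {X} Π Σ Γ Δ h = subst₂ _<_
  (sym (trans (cong₂ _+_ (measure-++ Π Γ) (measure-++ Σ Δ)) (+-interchange (measure Π) _ _ _)))
  (sym (+-assoc (weight X) (measure Γ) (measure Δ)))
  (+-monoˡ-< (measure Γ + measure Δ) (subst (_< weight X) (measure-++ Π Σ) h))
  where
  open CommutativeSemigroupProperties +-commutativeSemigroup
    using () renaming (interchange to +-interchange)

lighter-right : ∀ {X} Π Σ Δ → Lighter X (Π , Σ) →
                measure Π + measure (Σ ++ Δ) < measure (X ∷ Δ)
lighter-right {X} Π Σ Δ h = subst (_< weight X + measure Δ)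
  (trans (+-assoc (measure Π) (measure Σ) (measure Δ)) (cong (measure Π +_) (sym (measure-++ Σ Δ))))
  (+-monoˡ-< (measure Δ) (subst (_< weight X) (measure-++ Π Σ) h))

_∉𝒜_ : Ax → AxSet → Set
a ∉𝒜 𝒜 = 𝒜 a ≡ false

module SequentCalculus (𝒜 : AxSet) where

  ∈𝒜⇒¬∉𝒜 : ∀ {a} → a ∈𝒜 𝒜 → ¬ a ∉𝒜 𝒜
  ∈𝒜⇒¬∉𝒜 a∈ a∉ with () ← trans (sym a∈) a∉

  ∈𝒜? : ∀ a → a ∈𝒜 𝒜 ⊎ a ∉𝒜 𝒜
  ∈𝒜? a with 𝒜 a
  ... | true  = inj₁ refl
  ... | false = inj₂ refl

  ModalArity : List Fm → Set
  ModalArity As = (N ∉𝒜 𝒜 → 1 ≤ length As) × (C ∉𝒜 𝒜 → length As ≤ 1)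

  singleton-arity : ∀ {A} → ModalArity [ A ]
  singleton-arity = (λ _ → s≤s z≤n) , (λ _ → s≤s z≤n)

  infix 3 _⊢_
  data _⊢_ : List Fm → List Fm → Set

  Premiss⊢ : List Fm → List Fm → Premiss → Set
  Premiss⊢ Γ Δ (Π , Σ) = Π ++ Γ ⊢ Σ ++ Δ

  Premisses : List Fm → List Fm → List Premiss → Set
  Premisses Γ Δ ps = ∀ {p} → p ∈ ps → Premiss⊢ Γ Δ p

  record ModalPremisses (As : List Fm) (B : Fm) : Set where
    inductive
    field
      arity    : ModalArity As
      main     : As ⊢ [ B ]
      converse : M ∉𝒜 𝒜 → ∀ {A} → A ∈ As → [ B ] ⊢ [ A ]

  data _⊢_ where
    ax    : ∀ {Γ Δ n} → var n ∈ Γ → var n ∈ Δ → Γ ⊢ Δ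
    left  : ∀ {Γ Δ A} → A ∈ Γ → (c : NonAtomic A) → Premisses Γ Δ (leftPremisses c) → Γ ⊢ Δ
    right : ∀ {Γ Δ A} → A ∈ Δ → (c : NonAtomic A) → Premisses Γ Δ (rightPremisses c) → Γ ⊢ Δ
    modal : ∀ {Γ Δ B} As → All (λ A → □ A ∈ Γ) As → □ B ∈ Δ → ModalPremisses As B → Γ ⊢ Δ

  premisses : ∀ {Γ Δ ps} → All (Premiss⊢ Γ Δ) ps → Premisses Γ Δ ps
  premisses = lookup

  weaken : ∀ {Γ Γ′ Δ Δ′} → Γ ⊆ Γ′ → Δ ⊆ Δ′ → Γ ⊢ Δ → Γ′ ⊢ Δ′
  weaken s t (ax p q)          = ax (s p) (t q)
  weaken s t (left m c ds)     = left (s m) c λ {(Π , Σ)} i → weaken (++⁺ʳ Π s) (++⁺ʳ Σ t) (ds i)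
  weaken s t (right m c ds)    = right (t m) c λ {(Π , Σ)} i → weaken (++⁺ʳ Π s) (++⁺ʳ Σ t) (ds i)
  weaken s t (modal As bs m P) = modal As (All.map s bs) (t m) P

  □-mono : ∀ {A B Γ Δ} → □ A ∈ Γ → □ B ∈ Δ → [ A ] ⊢ [ B ] → (M ∉𝒜 𝒜 → [ B ] ⊢ [ A ]) → Γ ⊢ Δ
  □-mono {A} a b d e = modal [ A ] (a ∷ []) b record
    { arity    = singleton-arity {A}
    ; main     = d
    ; converse = λ { M∉ (here refl) → e M∉ }
    }

  identity : ∀ A {Γ Δ} → A ∈ Γ → A ∈ Δ → Γ ⊢ Δ
  identity (var n)  p q = ax p q
  identity ⊥ᶠ       p q = left p ⊥ⁿ λ ()
  identity ⊤ᶠ       p q = right q ⊤ⁿ λ ()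
  identity (¬ᶠ A)   p q = right q ¬ⁿ (premisses
    (left (there p) ¬ⁿ (premisses (identity A (here refl) (here refl) ∷ [])) ∷ []))
  identity (A ∧ᶠ B) p q = right q ∧ⁿ (premisses
    ( left p ∧ⁿ (premisses (identity A (here refl) (here refl) ∷ []))
    ∷ left p ∧ⁿ (premisses (identity B (there (here refl)) (here refl) ∷ [])) ∷ []))
  identity (A ∨ᶠ B) p q = right q ∨ⁿ (premisses
    (left p ∨ⁿ (premisses ( identity A (here refl) (here refl)
                          ∷ identity B (here refl) (there (here refl)) ∷ [])) ∷ []))
  identity (A →ᶠ B) p q = right q →ⁿ (premisses
    (left (there p) →ⁿ (premisses ( identity B (here refl) (here refl)
                                  ∷ identity A (here refl) (here refl) ∷ [])) ∷ []))
  identity (□ A)    p q =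
    □-mono p q (identity A (here refl) (here refl)) λ _ → identity A (here refl) (here refl)

  -- Inversion, generalised so that the principal formula may be principal again above.
  module _ {A} (c : NonAtomic A) where

    invertLeft′ : ∀ {Π Σ Γ₀ Δ₀ Γ Δ} → (Π , Σ) ∈ leftPremisses c → Γ₀ ⊢ Δ₀ →
                  Γ₀ ⊆ A ∷ Γ → Δ₀ ⊆ Δ → Π ⊆ Γ → Σ ⊆ Δ → Γ ⊢ Δ
    invertLeft′ i (ax p q) s t πs σs =
      ax (tail (nonAtomic≢atomic c varᵃ ∘ sym) (s p)) (t q)
    invertLeft′ i (left m c′ ds) s t πs σs with s m
    ... | here refl with refl ← nonAtomic-irrelevant c c′ =
      invertLeft′ i (ds i) (++-⊆ (⊆-trans πs (xs⊆x∷xs _ A)) s) (++-⊆ σs t) πs σs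
    ... | there m′ = left m′ c′ λ {(Π′ , Σ′)} j →
      invertLeft′ i (ds j) (∷-++-⊆ Π′ s) (++⁺ʳ Σ′ t)
                  (⊆-trans πs (xs⊆ys++xs _ Π′)) (⊆-trans σs (xs⊆ys++xs _ Σ′))
    invertLeft′ i (right m c′ ds) s t πs σs = right (t m) c′ λ {(Π′ , Σ′)} j →
      invertLeft′ i (ds j) (∷-++-⊆ Π′ s) (++⁺ʳ Σ′ t)
                  (⊆-trans πs (xs⊆ys++xs _ Π′)) (⊆-trans σs (xs⊆ys++xs _ Σ′))
    invertLeft′ i (modal As bs m P) s t πs σs =
      modal As (All.map (tail (nonAtomic≢atomic c □ᵃ ∘ sym) ∘ s) bs) (t m) P

    invertRight′ : ∀ {Π Σ Γ₀ Δ₀ Γ Δ} → (Π , Σ) ∈ rightPremisses c → Γ₀ ⊢ Δ₀ →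
                   Γ₀ ⊆ Γ → Δ₀ ⊆ A ∷ Δ → Π ⊆ Γ → Σ ⊆ Δ → Γ ⊢ Δ
    invertRight′ i (ax p q) s t πs σs =
      ax (s p) (tail (nonAtomic≢atomic c varᵃ ∘ sym) (t q))
    invertRight′ i (left m c′ ds) s t πs σs = left (s m) c′ λ {(Π′ , Σ′)} j →
      invertRight′ i (ds j) (++⁺ʳ Π′ s) (∷-++-⊆ Σ′ t)
                   (⊆-trans πs (xs⊆ys++xs _ Π′)) (⊆-trans σs (xs⊆ys++xs _ Σ′))
    invertRight′ i (right m c′ ds) s t πs σs with t m
    ... | here refl with refl ← nonAtomic-irrelevant c c′ =
      invertRight′ i (ds i) (++-⊆ πs s) (++-⊆ (⊆-trans σs (xs⊆x∷xs _ A)) t) πs σs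
    ... | there m′ = right m′ c′ λ {(Π′ , Σ′)} j →
      invertRight′ i (ds j) (++⁺ʳ Π′ s) (∷-++-⊆ Σ′ t)
                   (⊆-trans πs (xs⊆ys++xs _ Π′)) (⊆-trans σs (xs⊆ys++xs _ Σ′))
    invertRight′ i (modal As bs m P) s t πs σs =
      modal As (All.map s bs) (tail (nonAtomic≢atomic c □ᵃ ∘ sym) (t m)) P

    invertLeft : ∀ {Π Σ Γ Δ} → (Π , Σ) ∈ leftPremisses c → A ∷ Γ ⊢ Δ → Π ++ Γ ⊢ Σ ++ Δ
    invertLeft {Π} {Σ} {Γ} {Δ} i d =
      invertLeft′ i d (∷⁺ʳ A (xs⊆ys++xs Γ Π)) (xs⊆ys++xs Δ Σ) (xs⊆xs++ys Π Γ) (xs⊆xs++ys Σ Δ)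

    invertRight : ∀ {Π Σ Γ Δ} → (Π , Σ) ∈ rightPremisses c → Γ ⊢ A ∷ Δ → Π ++ Γ ⊢ Σ ++ Δ
    invertRight {Π} {Σ} {Γ} {Δ} i d =
      invertRight′ i d (xs⊆ys++xs Γ Π) (∷⁺ʳ A (xs⊆ys++xs Δ Σ)) (xs⊆xs++ys Π Γ) (xs⊆xs++ys Σ Δ)

  weaken-below : ∀ {X Γ Δ} Π Σ → X ∷ Γ ⊢ Δ → X ∷ Π ++ Γ ⊢ Σ ++ Δ
  weaken-below {X} {Γ} {Δ} Π Σ = weaken (∷⁺ʳ X (xs⊆ys++xs Γ Π)) (xs⊆ys++xs Δ Σ)

  cut-var : ∀ {n Γ Δ Δ₀} → Γ ⊢ Δ₀ → Δ₀ ⊆ var n ∷ Δ → var n ∷ Γ ⊢ Δ → Γ ⊢ Δ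
  cut-var (ax p q) t e with t q
  ... | here refl = weaken (∈-∷⁺ʳ p ⊆-refl) ⊆-refl e
  ... | there q′  = ax p q′
  cut-var (left m c ds) t e =
    left m c λ {(Π , Σ)} i → cut-var (ds i) (∷-++-⊆ Σ t) (weaken-below Π Σ e)
  cut-var (right m c ds) t e =
    right (tail (nonAtomic≢atomic c varᵃ) (t m)) c λ {(Π , Σ)} i →
      cut-var (ds i) (∷-++-⊆ Σ t) (weaken-below Π Σ e)
  cut-var (modal As bs m P) t e = modal As bs (tail (λ ()) (t m)) P

  module _ {B} (cut-B : ∀ {Γ Δ} → Γ ⊢ B ∷ Δ → B ∷ Γ ⊢ Δ → Γ ⊢ Δ) where
    open ModalPremisses

    -- A modal rule concluding □B and one using □B among its boxed antecedents merge into a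
    -- single modal rule whose premisses are cuts on B.
    merge : ∀ {As Cs D} → ModalPremisses As B → ModalPremisses Cs D → B ∈ Cs →
            ModalPremisses (As ++ without B Cs) D
    merge {As} {Cs} {D} P Q B∈Cs = record
      { arity    =
          (λ N∉ → ≤-trans (proj₁ (arity P) N∉) (length-++-≤ˡ As)) ,
          (λ C∉ → subst (_≤ 1) (sym (length-++ As))
                    (+-mono-≤ (proj₂ (arity P) C∉)
                              (ℕ.≤-pred (≤-trans (without-shorter B∈Cs) (proj₂ (arity Q) C∉)))))
      ; main     = cut-B (weaken (xs⊆xs++ys As Cs′) (∷⁺ʳ B λ ()) (main P))
                         (weaken (⊆-trans (⊆-∷-without B Cs) (∷⁺ʳ B (xs⊆ys++xs Cs′ As))) ⊆-refl
                                 (main Q))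
      ; converse = λ M∉ i → converse′ M∉ (∈-++⁻ As i)
      }
      where
      Cs′ = without B Cs
      converse′ : ∀ {A} → M ∉𝒜 𝒜 → A ∈ As ⊎ A ∈ Cs′ → [ D ] ⊢ [ A ]
      converse′ M∉ (inj₁ i) = cut-B (weaken ⊆-refl (∷⁺ʳ B λ ()) (converse Q M∉ B∈Cs))
                                    (weaken (∷⁺ʳ B λ ()) ⊆-refl (converse P M∉ i))
      converse′ M∉ (inj₂ i) = converse Q M∉ (proj₁ (∈-filter⁻ (_≢? B) i))

    cut-principal-box : ∀ {As Γ Γ₀ Δ} → All (λ A → □ A ∈ Γ) As → ModalPremisses As B →
                        Γ₀ ⊢ Δ → Γ₀ ⊆ □ B ∷ Γ → Γ ⊢ Δ
    cut-principal-box bs P (ax p q) s = ax (tail (λ ()) (s p)) q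
    cut-principal-box bs P (left m c ds) s =
      left (tail (nonAtomic≢atomic c □ᵃ) (s m)) c λ {(Π , Σ)} i →
        cut-principal-box (All.map (xs⊆ys++xs _ Π) bs) P (ds i) (∷-++-⊆ Π s)
    cut-principal-box bs P (right m c ds) s =
      right m c λ {(Π , Σ)} i →
        cut-principal-box (All.map (xs⊆ys++xs _ Π) bs) P (ds i) (∷-++-⊆ Π s)
    cut-principal-box {As} bs P (modal Cs bs′ m Q) s with B ∈? Cs
    ... | no B∉  = modal Cs (boxes-∉ B∉ (All.map s bs′)) m Q
    ... | yes B∈ = modal (As ++ without B Cs) (All.++⁺ bs (boxes-without (All.map s bs′))) m
                         (merge P Q B∈)

    cut-box : ∀ {Γ Δ Δ₀} → Γ ⊢ Δ₀ → Δ₀ ⊆ □ B ∷ Δ → □ B ∷ Γ ⊢ Δ → Γ ⊢ Δ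
    cut-box (ax p q) t e = ax p (tail (λ ()) (t q))
    cut-box (left m c ds) t e =
      left m c λ {(Π , Σ)} i → cut-box (ds i) (∷-++-⊆ Σ t) (weaken-below Π Σ e)
    cut-box (right m c ds) t e =
      right (tail (nonAtomic≢atomic c □ᵃ) (t m)) c λ {(Π , Σ)} i →
        cut-box (ds i) (∷-++-⊆ Σ t) (weaken-below Π Σ e)
    cut-box (modal As bs m P) t e with t m
    ... | here refl = cut-principal-box bs P e ⊆-refl
    ... | there m′  = modal As bs m′ P

  cut : ∀ A {Γ Δ} → Γ ⊢ A ∷ Δ → A ∷ Γ ⊢ Δ → Γ ⊢ Δ
  cut (var n)  d e = cut-var d ⊆-refl e
  cut (□ B)    d e = cut-box (cut B) d ⊆-refl e
  cut ⊥ᶠ       d e = invertRight ⊥ⁿ (here refl) d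
  cut ⊤ᶠ       d e = invertLeft ⊤ⁿ (here refl) e
  cut (¬ᶠ A)   d e = cut A (invertLeft ¬ⁿ (here refl) e) (invertRight ¬ⁿ (here refl) d)
  cut (A ∧ᶠ B) d e =
    cut A (invertRight ∧ⁿ (here refl) d)
          (cut B (weaken (xs⊆x∷xs _ A) ⊆-refl (invertRight ∧ⁿ (there (here refl)) d))
                 (weaken swap-⊆ ⊆-refl (invertLeft ∧ⁿ (here refl) e)))
  cut (A ∨ᶠ B) d e =
    cut A (cut B (weaken ⊆-refl swap-⊆ (invertRight ∨ⁿ (here refl) d))
                 (weaken ⊆-refl (xs⊆x∷xs _ A) (invertLeft ∨ⁿ (there (here refl)) e)))
          (invertLeft ∨ⁿ (here refl) e)
  cut (A →ᶠ B) d e =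
    cut A (invertLeft →ⁿ (there (here refl)) e)
          (cut B (invertRight →ⁿ (here refl) d)
                 (weaken (∷⁺ʳ B (xs⊆x∷xs _ A)) ⊆-refl (invertLeft →ⁿ (here refl) e)))

  -- The countervaluation of an atomic sequent: an atom is true iff it occurs on the left.
  module _ (Λ : List Fm) where

    valuation : ℕ → Bool
    valuation n = does (var n ∈? Λ)

    boxValuation : Fm → Bool
    boxValuation B = does (□ B ∈? Λ)

    ∈⇒holds : ∀ {X} → Atomic X → X ∈ Λ → Holds valuation boxValuation X
    ∈⇒holds varᵃ = dec-true (_ ∈? Λ)
    ∈⇒holds □ᵃ   = dec-true (_ ∈? Λ)

    holds⇒∈ : ∀ {X} → Atomic X → Holds valuation boxValuation X → X ∈ Λ
    holds⇒∈ varᵃ = from-does (_ ∈? Λ)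
    holds⇒∈ □ᵃ   = from-does (_ ∈? Λ)

  complete-atomic : ∀ {Λ Ρ} → All Atomic Λ → All Atomic Ρ → Valid Λ Ρ → Λ ⊢ Ρ
  complete-atomic {Λ} {Ρ} aΛ aΡ V with Any.any? (_∈? Ρ) Λ
  ... | yes shared = let (X , X∈Λ , X∈Ρ) = find shared in identity X X∈Λ X∈Ρ
  ... | no disjoint =
    let (Y , Y∈Ρ , hY) = find (V (valuation Λ) (boxValuation Λ)
                                 (All.tabulate λ i → ∈⇒holds Λ (lookup aΛ i) i))
    in ⊥-elim (disjoint (lose (holds⇒∈ Λ (lookup aΡ Y∈Ρ) hY) Y∈Ρ))

  -- Γ and Δ are still to be decomposed, Λ and Ρ are atomic.
  complete : ∀ Γ Δ {Λ Ρ} → Acc _<_ (measure Γ + measure Δ) → All Atomic Λ → All Atomic Ρ →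
             Valid (Γ ++ Λ) (Δ ++ Ρ) → Γ ++ Λ ⊢ Δ ++ Ρ
  complete [] [] _ aΛ aΡ V = complete-atomic aΛ aΡ V
  complete (X ∷ Γ) Δ {Λ} {Ρ} (acc rec) aΛ aΡ V with atomic? X
  ... | inj₁ a =
    weaken (⊆-reflexive-↭ (shift X Γ Λ)) ⊆-refl
      (complete Γ Δ (rec (+-monoˡ-< (measure Δ) (m<n+m (measure Γ) (atomic-weight a))))
                (a ∷ aΛ) aΡ (valid-weaken (⊆-reflexive-↭ (↭-sym (shift X Γ Λ))) ⊆-refl V))
  ... | inj₂ c = left (here refl) c λ {(Π , Σ)} i →
    weaken (⊆-trans (⊆-reflexive (++-assoc Π Γ Λ)) (++⁺ʳ Π (xs⊆x∷xs _ X)))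
           (⊆-reflexive (++-assoc Σ Δ Ρ))
      (complete (Π ++ Γ) (Σ ++ Δ) (rec (lighter-left Π Σ Γ Δ (lookup (leftPremisses-lighter c) i)))
                aΛ aΡ (valid-weaken (⊆-reflexive (sym (++-assoc Π Γ Λ)))
                                    (⊆-reflexive (sym (++-assoc Σ Δ Ρ))) (valid-left c i V)))
  complete [] (X ∷ Δ) {Λ} {Ρ} (acc rec) aΛ aΡ V with atomic? X
  ... | inj₁ a =
    weaken ⊆-refl (⊆-reflexive-↭ (shift X Δ Ρ))
      (complete [] Δ (rec (m<n+m (measure Δ) (atomic-weight a)))
                aΛ (a ∷ aΡ) (valid-weaken ⊆-refl (⊆-reflexive-↭ (↭-sym (shift X Δ Ρ))) V))
  ... | inj₂ c = right (here refl) c λ {(Π , Σ)} i →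
    weaken ⊆-refl (⊆-trans (⊆-reflexive (++-assoc Σ Δ Ρ)) (++⁺ʳ Σ (xs⊆x∷xs _ X)))
      (complete Π (Σ ++ Δ) (rec (lighter-right Π Σ Δ (lookup (rightPremisses-lighter c) i)))
                aΛ aΡ (valid-weaken ⊆-refl (⊆-reflexive (sym (++-assoc Σ Δ Ρ)))
                                    (valid-right c i V)))

  tautology⇒⊢ : ∀ {A} → Tautology A → [] ⊢ [ A ]
  tautology⇒⊢ {A} t = complete [] [ A ] (<-wellFounded _) [] [] λ v w _ → here (t v w)

  implication⇒⊢ : ∀ {A B} → [] ⊢ [ A →ᶠ B ] → [ A ] ⊢ [ B ]
  implication⇒⊢ = invertRight →ⁿ (here refl)

  ∧-elimˡ : ∀ {A B} → [ A ∧ᶠ B ] ⊢ [ A ]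
  ∧-elimˡ {A} = left (here refl) ∧ⁿ (premisses (identity A (here refl) (here refl) ∷ []))

  ∧-elimʳ : ∀ {A B} → [ A ∧ᶠ B ] ⊢ [ B ]
  ∧-elimʳ {B = B} =
    left (here refl) ∧ⁿ (premisses (identity B (there (here refl)) (here refl) ∷ []))

  theorem⇒⊢ : ∀ {A} → Thm 𝒜 A → [] ⊢ [ A ]
  theorem⇒⊢ (taut t) = tautology⇒⊢ t
  theorem⇒⊢ (mp {A} d e) =
    cut A (weaken ⊆-refl (∷⁺ʳ A λ ()) (theorem⇒⊢ e)) (implication⇒⊢ (theorem⇒⊢ d))
  theorem⇒⊢ (ruleE d e) = right (here refl) →ⁿ (premisses
    (□-mono (here refl) (here refl) (implication⇒⊢ (theorem⇒⊢ d))
            (λ _ → implication⇒⊢ (theorem⇒⊢ e)) ∷ []))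
  theorem⇒⊢ (axM M∈) = right (here refl) →ⁿ (premisses
    (right (here refl) ∧ⁿ (premisses
      ( □-mono (here refl) (here refl) ∧-elimˡ (⊥-elim ∘ ∈𝒜⇒¬∉𝒜 M∈)
      ∷ □-mono (here refl) (here refl) ∧-elimʳ (⊥-elim ∘ ∈𝒜⇒¬∉𝒜 M∈) ∷ [])) ∷ []))
  theorem⇒⊢ (axC {A} {B} C∈) = right (here refl) →ⁿ (premisses
    (left (here refl) ∧ⁿ (premisses
      (modal (A ∷ B ∷ []) (here refl ∷ there (here refl) ∷ []) (here refl) record
        { arity    = (λ _ → s≤s z≤n) , ⊥-elim ∘ ∈𝒜⇒¬∉𝒜 C∈
        ; main     = right (here refl) ∧ⁿ (premisses
            (identity A (here refl) (here refl) ∷ identity B (there (here refl)) (here refl) ∷ []))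
        ; converse = λ { _ (here refl) → ∧-elimˡ ; _ (there (here refl)) → ∧-elimʳ }
        } ∷ [])) ∷ []))
  theorem⇒⊢ (axN N∈) = modal [] [] (here refl) record
    { arity    = ⊥-elim ∘ ∈𝒜⇒¬∉𝒜 N∈ , λ _ → z≤n
    ; main     = right (here refl) ⊤ⁿ λ ()
    ; converse = λ _ ()
    }

  Derivable : Seq → Set
  Derivable s = ∀ G → Der 𝒜 (fill G s nil)

  nest : ∀ {t} → Derivable t → ∀ G s → Der 𝒜 (fill G s (more (end t)))
  nest {t} d G s = subst (Der 𝒜) (sym (fill-more G s t)) (d (G ++ [ s ]))

  -- □A₁, …, □Aₙ are removed one at a time: by C while more than one remains, then by □ᵉL.
  □ᵉL* : ∀ G Γ Δ A As Σ Π Ω Θ → (C ∉𝒜 𝒜 → length (A ∷ As) ≤ 1) →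
               (∀ {Λ} → A ∷ As ++ Σ ⊆ Λ → Derivable (Λ ⇒ Π)) →
               (∀ {X} → X ∈ A ∷ As → Derivable (Ω ⇒ X ∷ Θ)) →
               Der 𝒜 (fill G (map □_ (A ∷ As) ++ Γ ⇒ Δ) (eN (Σ ⇒ Π) (Ω ⇒ Θ)))
  □ᵉL* G Γ Δ A [] Σ Π Ω Θ _ main side =
    □ᵉL (nest (main ⊆-refl) G (Γ ⇒ Δ)) (nest (side (here refl)) G (Γ ⇒ Δ))
  □ᵉL* G Γ Δ A (A′ ∷ As) Σ Π Ω Θ arity main side with ∈𝒜? C
  ... | inj₂ C∉ with s≤s () ← arity C∉
  ... | inj₁ C∈ = ruleC C∈
    (□ᵉL* G Γ Δ A′ As (A ∷ Σ) Π Ω Θ (⊥-elim ∘ ∈𝒜⇒¬∉𝒜 C∈)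
                (main ∘ ⊆-trans (⊆-reflexive-↭ (↭-sym (shift A (A′ ∷ As) Σ)))) (side ∘ there))
    (nest (side (here refl)) G (map □_ (A′ ∷ As) ++ Γ ⇒ Δ))

  modal⇒Der : ∀ As {B} → ModalArity As → Derivable (As ⇒ [ B ]) →
               (M ∉𝒜 𝒜 → ∀ {X} → X ∈ As → Derivable ([ B ] ⇒ [ X ])) →
               ∀ G Γ Δ → Der 𝒜 (fill G (map □_ As ++ Γ ⇒ □ B ∷ Δ) nil)
  modal⇒Der [] (arity , _) main _ G Γ Δ with ∈𝒜? N
  ... | inj₂ N∉ with () ← arity N∉
  ... | inj₁ N∈ = ruleN N∈ (nest main G (Γ ⇒ Δ))
  modal⇒Der (A ∷ As) {B} (_ , arity) main converse G Γ Δ = □ᵉR below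
    where
    main′ : ∀ {Λ} → A ∷ As ++ [] ⊆ Λ → Derivable (Λ ⇒ [ B ])
    main′ s G′ = Der-⊆ (⊆-trans (xs⊆xs++ys (A ∷ As) []) s) ⊆-refl (main G′)

    below : Der 𝒜 (fill G (map □_ (A ∷ As) ++ Γ ⇒ Δ) (eN ([] ⇒ [ B ]) ([ B ] ⇒ [])))
    below with ∈𝒜? M
    ... | inj₁ M∈ = ruleM M∈ (□ᵉL* G Γ Δ A As [] [ B ] (⊥ᶠ ∷ [ B ]) [] arity main′ λ _ _ → ⊥L)
    ... | inj₂ M∉ = □ᵉL* G Γ Δ A As [] [ B ] [ B ] [] arity main′ (converse M∉)

  ⊢⇒Der : ∀ {Γ Δ} → Γ ⊢ Δ → Derivable (Γ ⇒ Δ)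
  ⊢⇒Der (ax p q) G = Der-⊆ (∈-∷⁺ʳ p λ ()) (∈-∷⁺ʳ q λ ()) (init {Γ = []} {Δ = []})
  ⊢⇒Der (left m ⊥ⁿ ds) G = contractˡ m ⊥L
  ⊢⇒Der (left m ⊤ⁿ ds) G = ⊢⇒Der (ds (here refl)) G
  ⊢⇒Der (left m ¬ⁿ ds) G = contractˡ m (¬L (⊢⇒Der (ds (here refl)) G))
  ⊢⇒Der (left m ∧ⁿ ds) G = contractˡ m (∧L (⊢⇒Der (ds (here refl)) G))
  ⊢⇒Der (left m ∨ⁿ ds) G =
    contractˡ m (∨L (⊢⇒Der (ds (here refl)) G) (⊢⇒Der (ds (there (here refl))) G))
  ⊢⇒Der (left m →ⁿ ds) G =
    contractˡ m (→L (⊢⇒Der (ds (here refl)) G) (⊢⇒Der (ds (there (here refl))) G))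
  ⊢⇒Der (right m ⊥ⁿ ds) G = ⊢⇒Der (ds (here refl)) G
  ⊢⇒Der (right m ⊤ⁿ ds) G = contractʳ m ⊤R
  ⊢⇒Der (right m ¬ⁿ ds) G = contractʳ m (¬R (⊢⇒Der (ds (here refl)) G))
  ⊢⇒Der (right m ∧ⁿ ds) G =
    contractʳ m (∧R (⊢⇒Der (ds (here refl)) G) (⊢⇒Der (ds (there (here refl))) G))
  ⊢⇒Der (right m ∨ⁿ ds) G = contractʳ m (∨R (⊢⇒Der (ds (here refl)) G))
  ⊢⇒Der (right m →ⁿ ds) G = contractʳ m (→R (⊢⇒Der (ds (here refl)) G))
  ⊢⇒Der {Γ} {Δ} (modal As bs m record { arity = arity ; main = d ; converse = ds }) G =
    Der-⊆ (++-⊆ (boxes-⊆ bs) ⊆-refl) (∈-∷⁺ʳ m ⊆-refl)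
      (modal⇒Der As arity (⊢⇒Der d) (λ M∉ i → ⊢⇒Der (ds M∉ i)) G Γ Δ)

mainTheorem6 : (𝒜 : AxSet) (A : Fm) → Thm 𝒜 A → Der 𝒜 (end ([] ⇒ A ∷ []))
mainTheorem6 𝒜 A ⊢A = ⊢⇒Der (theorem⇒⊢ ⊢A) []
  where open SequentCalculus 𝒜
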